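{- For every type $A$, $[[[A]]]\le^a[[0,0],A,A]$.
   Context: Simply typed $\lambda$-calculus over base type $0$; every type is uniquely $[B_1,\dots,B_m]:=B_1\to\cdots\to B_m\to0$ (so $[0,0]=0\to0\to0$). A context $\Gamma=x_1^{C_1},\dots,x_k^{C_k}$ is a finite list of distinct typed variables, $\{\Gamma\}$ its set, $[\Gamma]:=[C_1,\dots,C_k]$; terms identified up to $\beta\eta$ ($=_{\beta\eta}$); $\Lambda^\Xi(A)$ = terms of type $A$ with free variables in $\{\Xi\}$. A substitution $\varrho$ from $\Gamma$ to $\Delta$ assigns $\varrho_c\in\Lambda^\Delta(C)$ to each $c^C\in\{\Gamma\}$; for a fresh context $\Xi$, $\varrho^\Xi$ is $\varrho$ on $\{\Gamma\}$ and the identity on $\{\Xi\}$. $\varrho$ is an atomic reduction if for every fresh $\Xi$, all $a^A,b^B\in\{\Xi,\Gamma\}$ with $A\equiv[A_1,\dots,A_n]$, $B\equiv[B_1,\dots,B_m]$, and all $M_i\in\Lambda^{\Xi,\Delta}(A_i)$, $N_i\in\Lambda^{\Xi,\Delta}(B_i)$: $\varrho^\Xi_aM_1\cdots M_n=_{\beta\eta}\varrho^\Xi_bN_1\cdots N_m$ implies $a=b$ and all $M_i=N_i$. For types, $[\Gamma]\le^a[\Delta]$ means there is an atomic reduction from the context $\Gamma$ to the context $\Delta$. -}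

module Defs where

open import Data.List using (List; []; _∷_; _++_)
open import Data.Unit using (⊤; tt)
open import Data.Product using (Σ; _×_; _,_)

-- Simple types over the single base type 0 (written `o`).

infixr 7 _⇒_
data Ty : Set where
  o   : Ty
  _⇒_ : Ty → Ty → Ty

⟦_⟧ : List Ty → Ty
⟦ [] ⟧    = o
⟦ B ∷ Bs ⟧ = B ⇒ ⟦ Bs ⟧

-- the unique list Bs with A ≡ ⟦ Bs ⟧
args : Ty → List Ty
args o       = []
args (A ⇒ B) = A ∷ args B

-- Contexts (de Bruijn: a context x₁^{C₁},…,x_k^{C_k} is the list
-- C₁ ∷ … ∷ C_k ∷ []; distinct variables = distinct positions).

Ctx : Set
Ctx = List Ty

infix 4 _∋_
data _∋_ : Ctx → Ty → Set where
  here  : ∀ {Γ A} → (A ∷ Γ) ∋ A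
  there : ∀ {Γ A B} → Γ ∋ A → (B ∷ Γ) ∋ A

-- Intrinsically typed terms: Tm Γ A = Λ^Γ(A) (before quotienting)
data Tm (Γ : Ctx) : Ty → Set where
  var : ∀ {A} → Γ ∋ A → Tm Γ A
  lam : ∀ {A B} → Tm (A ∷ Γ) B → Tm Γ (A ⇒ B)
  app : ∀ {A B} → Tm Γ (A ⇒ B) → Tm Γ A → Tm Γ B

Ren : Ctx → Ctx → Set
Ren Γ Δ = ∀ {A} → Γ ∋ A → Δ ∋ A

ext : ∀ {Γ Δ B} → Ren Γ Δ → Ren (B ∷ Γ) (B ∷ Δ)
ext r here      = here
ext r (there x) = there (r x)

rename : ∀ {Γ Δ A} → Ren Γ Δ → Tm Γ A → Tm Δ A
rename r (var x)   = var (r x)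
rename r (lam t)   = lam (rename (ext r) t)
rename r (app t u) = app (rename r t) (rename r u)

Sub : Ctx → Ctx → Set
Sub Γ Δ = ∀ {A} → Γ ∋ A → Tm Δ A

exts : ∀ {Γ Δ B} → Sub Γ Δ → Sub (B ∷ Γ) (B ∷ Δ)
exts σ here      = var here
exts σ (there x) = rename there (σ x)

subst : ∀ {Γ Δ A} → Sub Γ Δ → Tm Γ A → Tm Δ A
subst σ (var x)   = σ x
subst σ (lam t)   = lam (subst (exts σ) t)
subst σ (app t u) = app (subst σ t) (subst σ u)

σ₀ : ∀ {Γ B} → Tm Γ B → Sub (B ∷ Γ) Γ
σ₀ u here      = u
σ₀ u (there x) = var x

_[_] : ∀ {Γ A B} → Tm (B ∷ Γ) A → Tm Γ B → Tm Γ A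
t [ u ] = subst (σ₀ u) t

infix 4 _≈_
data _≈_ : ∀ {Γ A} → Tm Γ A → Tm Γ A → Set where
  ≈refl  : ∀ {Γ A} {t : Tm Γ A} → t ≈ t
  ≈sym   : ∀ {Γ A} {t u : Tm Γ A} → t ≈ u → u ≈ t
  ≈trans : ∀ {Γ A} {t u v : Tm Γ A} → t ≈ u → u ≈ v → t ≈ v
  lam-cong : ∀ {Γ A B} {t t' : Tm (A ∷ Γ) B} → t ≈ t' → lam t ≈ lam t'
  app-cong : ∀ {Γ A B} {t t' : Tm Γ (A ⇒ B)} {u u' : Tm Γ A} →
             t ≈ t' → u ≈ u' → app t u ≈ app t' u'
  β : ∀ {Γ A B} (t : Tm (A ∷ Γ) B) (u : Tm Γ A) → app (lam t) u ≈ t [ u ]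
  η : ∀ {Γ A B} (t : Tm Γ (A ⇒ B)) → t ≈ lam (app (rename there t) (var here))

Args : Ctx → Ty → Set
Args Δ o       = ⊤
Args Δ (A ⇒ B) = Tm Δ A × Args Δ B

apps : ∀ {Δ A} → Tm Δ A → Args Δ A → Tm Δ o
apps {A = o}     h tt       = h
apps {A = A ⇒ B} h (M , Ms) = apps (app h M) Ms

ArgsEq : ∀ {Δ} A → Args Δ A → Args Δ A → Set
ArgsEq o       tt       tt       = ⊤
ArgsEq (A ⇒ B) (M , Ms) (N , Ns) = (M ≈ N) × ArgsEq B Ms Ns

data SameHeadArgs {Θ Δ : Ctx} : ∀ {A B} → Θ ∋ A → Args Δ A → Θ ∋ B → Args Δ B → Set where
  same : ∀ {A} {a : Θ ∋ A} {Ms Ns : Args Δ A} →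
         ArgsEq A Ms Ns → SameHeadArgs a Ms a Ns

-- ϱ^Ξ : the substitution from Ξ,Γ to Ξ,Δ that is ϱ on Γ and the
-- identity on the (fresh) context Ξ.

liftCtx : ∀ {Γ Δ} (Ξ : Ctx) → Sub Γ Δ → Sub (Ξ ++ Γ) (Ξ ++ Δ)
liftCtx []      ϱ = ϱ
liftCtx (B ∷ Ξ) ϱ = exts (liftCtx Ξ ϱ)

AtomicReduction : ∀ {Γ Δ} → Sub Γ Δ → Set
AtomicReduction {Γ} {Δ} ϱ =
  ∀ (Ξ : Ctx) {A B} (a : (Ξ ++ Γ) ∋ A) (b : (Ξ ++ Γ) ∋ B)
    (Ms : Args (Ξ ++ Δ) A) (Ns : Args (Ξ ++ Δ) B) →
    apps (liftCtx Ξ ϱ a) Ms ≈ apps (liftCtx Ξ ϱ b) Ns →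
    SameHeadArgs a Ms b Ns

infix 4 _≤ᵃ_
_≤ᵃ_ : Ty → Ty → Set
A ≤ᵃ B = Σ (Sub (args A) (args B)) AtomicReduction

-- The reduction ϱ sends x : ((A → 0) → 0) to λ f. p (f u) (f v), with p : 0 → 0 → 0 and
-- u, v : A fresh.  Everything is decided by comparing βη-normal forms, which are computed
-- by normalisation by evaluation in a Kripke model of partial equivalence relations: a
-- variable applied to arguments is convertible to another one only if the heads agree
-- and the arguments are convertible.  Hence a fresh head never meets ϱ x N, whose
-- normal form has head p, and ϱ x M ≈ ϱ x N yields M u ≈ N u and M v ≈ N v.  Since
-- u ≠ v, the renamings of the body of nf M sending its bound variable to u and to v are
-- jointly injective, so the two instances together determine M up to βη.

module Submission where

open import Defs
open import Data.List using ([]; _∷_; _++_)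
open import Data.Unit using (tt)
open import Data.Empty using (⊥-elim)
open import Data.Product using (∃; _×_; _,_; proj₁; proj₂)
open import Function using (id; _∘_)
open import Relation.Binary.PropositionalEquality
  using (_≡_; _≢_; refl; sym; trans; cong; cong₂; module ≡-Reasoning)
open import Relation.Binary.Bundles using (Setoid)
import Relation.Binary.Reasoning.Setoid as SetoidReasoning

private variable
  Γ Δ Θ Ξ : Ctx
  A B C D : Ty

≡⇒≈ : {t u : Tm Γ A} → t ≡ u → t ≈ u
≡⇒≈ refl = ≈refl

≈-setoid : Ctx → Ty → Setoid _ _
≈-setoid Γ A = record
  { Carrier       = Tm Γ A
  ; _≈_           = _≈_
  ; isEquivalence = record { refl = ≈refl ; sym = ≈sym ; trans = ≈trans }
  }

module ≈-Reasoning {Γ} {A} = SetoidReasoning (≈-setoid Γ A)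

≈-resp : {t t' u u' : Tm Γ A} → t ≈ t' → u ≈ u' → t ≈ u → t' ≈ u'
≈-resp p q e = ≈trans (≈sym p) (≈trans e q)

-- Renaming and substitution

ext-fusion : {r : Ren Γ Δ} {r' : Ren Δ Θ} {r'' : Ren Γ Θ} →
  (∀ {B} (x : Γ ∋ B) → r' (r x) ≡ r'' x) →
  ∀ {B} (x : (C ∷ Γ) ∋ B) → ext r' (ext r x) ≡ ext r'' x
ext-fusion h here      = refl
ext-fusion h (there x) = cong there (h x)

ext-id : {r : Ren Γ Γ} → (∀ {B} (x : Γ ∋ B) → r x ≡ x) →
  ∀ {B} (x : (C ∷ Γ) ∋ B) → ext r x ≡ x
ext-id h here      = refl
ext-id h (there x) = cong there (h x)

rename-fusion : (r : Ren Γ Δ) (r' : Ren Δ Θ) (r'' : Ren Γ Θ) →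
  (∀ {B} (x : Γ ∋ B) → r' (r x) ≡ r'' x) → (t : Tm Γ A) →
  rename r' (rename r t) ≡ rename r'' t
rename-fusion r r' r'' h (var x)   = cong var (h x)
rename-fusion r r' r'' h (lam t)   = cong lam (rename-fusion (ext r) (ext r') (ext r'') (ext-fusion h) t)
rename-fusion r r' r'' h (app t u) = cong₂ app (rename-fusion r r' r'' h t) (rename-fusion r r' r'' h u)

rename-id : (r : Ren Γ Γ) → (∀ {B} (x : Γ ∋ B) → r x ≡ x) → (t : Tm Γ A) → rename r t ≡ t
rename-id r h (var x)   = cong var (h x)
rename-id r h (lam t)   = cong lam (rename-id (ext r) (ext-id h) t)
rename-id r h (app t u) = cong₂ app (rename-id r h t) (rename-id r h u)

rename-there-ext : (r : Ren Γ Δ) (t : Tm Γ A) →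
  rename (there {B = B}) (rename r t) ≡ rename (ext r) (rename there t)
rename-there-ext r t =
  trans (rename-fusion r there (there ∘ r) (λ _ → refl) t)
        (sym (rename-fusion there (ext r) (there ∘ r) (λ _ → refl) t))

rename-subst : (r : Ren Δ Θ) (σ : Sub Γ Δ) (τ : Sub Γ Θ) →
  (∀ {B} (x : Γ ∋ B) → rename r (σ x) ≡ τ x) → (t : Tm Γ A) →
  rename r (subst σ t) ≡ subst τ t
rename-subst r σ τ h (var x)   = h x
rename-subst r σ τ h (lam t)   = cong lam (rename-subst (ext r) (exts σ) (exts τ) h' t)
  where
  h' : ∀ {B} (x : (_ ∷ _) ∋ B) → rename (ext r) (exts σ x) ≡ exts τ x
  h' here      = refl
  h' (there x) = trans (sym (rename-there-ext r (σ x))) (cong (rename there) (h x))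
rename-subst r σ τ h (app t u) = cong₂ app (rename-subst r σ τ h t) (rename-subst r σ τ h u)

subst-rename : (r : Ren Γ Δ) (σ : Sub Δ Θ) (τ : Sub Γ Θ) →
  (∀ {B} (x : Γ ∋ B) → σ (r x) ≡ τ x) → (t : Tm Γ A) →
  subst σ (rename r t) ≡ subst τ t
subst-rename r σ τ h (var x)   = h x
subst-rename r σ τ h (lam t)   = cong lam (subst-rename (ext r) (exts σ) (exts τ) h' t)
  where
  h' : ∀ {B} (x : (_ ∷ _) ∋ B) → exts σ (ext r x) ≡ exts τ x
  h' here      = refl
  h' (there x) = cong (rename there) (h x)
subst-rename r σ τ h (app t u) = cong₂ app (subst-rename r σ τ h t) (subst-rename r σ τ h u)

subst-fusion : (σ : Sub Γ Δ) (σ' : Sub Δ Θ) (τ : Sub Γ Θ) →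
  (∀ {B} (x : Γ ∋ B) → subst σ' (σ x) ≡ τ x) → (t : Tm Γ A) →
  subst σ' (subst σ t) ≡ subst τ t
subst-fusion σ σ' τ h (var x)   = h x
subst-fusion σ σ' τ h (lam t)   = cong lam (subst-fusion (exts σ) (exts σ') (exts τ) h' t)
  where
  h' : ∀ {B} (x : (_ ∷ _) ∋ B) → subst (exts σ') (exts σ x) ≡ exts τ x
  h' here      = refl
  h' (there x) =
    trans (subst-rename there (exts σ') (rename there ∘ σ') (λ _ → refl) (σ x))
      (trans (sym (rename-subst there σ' (rename there ∘ σ') (λ _ → refl) (σ x)))
             (cong (rename there) (h x)))
subst-fusion σ σ' τ h (app t u) = cong₂ app (subst-fusion σ σ' τ h t) (subst-fusion σ σ' τ h u)

subst-var : (σ : Sub Γ Δ) (r : Ren Γ Δ) → (∀ {B} (x : Γ ∋ B) → σ x ≡ var (r x)) →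
  (t : Tm Γ A) → subst σ t ≡ rename r t
subst-var σ r h (var x)   = h x
subst-var σ r h (lam t)   = cong lam (subst-var (exts σ) (ext r) h' t)
  where
  h' : ∀ {B} (x : (_ ∷ _) ∋ B) → exts σ x ≡ var (ext r x)
  h' here      = refl
  h' (there x) = cong (rename there) (h x)
subst-var σ r h (app t u) = cong₂ app (subst-var σ r h t) (subst-var σ r h u)

subst-id : (t : Tm Γ A) → subst var t ≡ t
subst-id t = trans (subst-var var id (λ _ → refl) t) (rename-id id (λ _ → refl) t)

rename-[] : (r : Ren Γ Δ) (t : Tm (A ∷ Γ) B) (u : Tm Γ A) →
  rename (ext r) t [ rename r u ] ≡ rename r (t [ u ])
rename-[] {Δ = Δ} {A = A} r t u =
  trans (subst-rename (ext r) (σ₀ (rename r u)) τ (λ { here → refl ; (there x) → refl }) t)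
        (sym (rename-subst r (σ₀ u) τ (λ { here → refl ; (there x) → refl }) t))
  where
  τ : Sub (A ∷ _) Δ
  τ here      = rename r u
  τ (there x) = var (r x)

rename-≈ : (r : Ren Γ Δ) {t u : Tm Γ A} → t ≈ u → rename r t ≈ rename r u
rename-≈ r ≈refl           = ≈refl
rename-≈ r (≈sym q)        = ≈sym (rename-≈ r q)
rename-≈ r (≈trans q q')   = ≈trans (rename-≈ r q) (rename-≈ r q')
rename-≈ r (lam-cong q)    = lam-cong (rename-≈ (ext r) q)
rename-≈ r (app-cong q q') = app-cong (rename-≈ r q) (rename-≈ r q')
rename-≈ r (β t u)         = ≈trans (β _ _) (≡⇒≈ (rename-[] r t u))
rename-≈ r (η t)           =
  ≈trans (η (rename r t)) (lam-cong (app-cong (≡⇒≈ (rename-there-ext r t)) ≈refl))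

-- βη-normal forms

data Nf (Γ : Ctx) : Ty → Set
data Sp (Γ : Ctx) : Ty → Ty → Set

data Nf Γ where
  nlam : Nf (A ∷ Γ) B → Nf Γ (A ⇒ B)
  nsp  : Γ ∋ A → Sp Γ A o → Nf Γ o

data Sp Γ where
  []  : Sp Γ C C
  _∷_ : Nf Γ A → Sp Γ B C → Sp Γ (A ⇒ B) C

data Ne (Γ : Ctx) (C : Ty) : Set where
  ne : Γ ∋ A → Sp Γ A C → Ne Γ C

_∷ʳ_ : Sp Γ A (B ⇒ C) → Nf Γ B → Sp Γ A C
[]      ∷ʳ n = n ∷ []
(m ∷ s) ∷ʳ n = m ∷ (s ∷ʳ n)

_++ˢ_ : Sp Γ A B → Sp Γ B C → Sp Γ A C
s ++ˢ []      = s
s ++ˢ (n ∷ t) = (s ∷ʳ n) ++ˢ t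

_·_ : Ne Γ (A ⇒ B) → Nf Γ A → Ne Γ B
ne x s · n = ne x (s ∷ʳ n)

renameNf : Ren Γ Δ → Nf Γ A → Nf Δ A
renameSp : Ren Γ Δ → Sp Γ A C → Sp Δ A C
renameNf r (nlam n)  = nlam (renameNf (ext r) n)
renameNf r (nsp x s) = nsp (r x) (renameSp r s)
renameSp r []        = []
renameSp r (n ∷ s)   = renameNf r n ∷ renameSp r s

renameNe : Ren Γ Δ → Ne Γ A → Ne Δ A
renameNe r (ne x s) = ne (r x) (renameSp r s)

renameSp-∷ʳ : (r : Ren Γ Δ) (s : Sp Γ A (B ⇒ C)) (n : Nf Γ B) →
  renameSp r (s ∷ʳ n) ≡ renameSp r s ∷ʳ renameNf r n
renameSp-∷ʳ r []      n = refl
renameSp-∷ʳ r (m ∷ s) n = cong (renameNf r m ∷_) (renameSp-∷ʳ r s n)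

renameNe-· : (r : Ren Γ Δ) (n : Ne Γ (A ⇒ B)) (m : Nf Γ A) →
  renameNe r (n · m) ≡ renameNe r n · renameNf r m
renameNe-· r (ne x s) m = cong (ne (r x)) (renameSp-∷ʳ r s m)

renameNf-fusion : (r : Ren Γ Δ) (r' : Ren Δ Θ) (r'' : Ren Γ Θ) →
  (∀ {B} (x : Γ ∋ B) → r' (r x) ≡ r'' x) → (n : Nf Γ A) →
  renameNf r' (renameNf r n) ≡ renameNf r'' n
renameSp-fusion : (r : Ren Γ Δ) (r' : Ren Δ Θ) (r'' : Ren Γ Θ) →
  (∀ {B} (x : Γ ∋ B) → r' (r x) ≡ r'' x) → (s : Sp Γ A C) →
  renameSp r' (renameSp r s) ≡ renameSp r'' s
renameNf-fusion r r' r'' h (nlam n)  =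
  cong nlam (renameNf-fusion (ext r) (ext r') (ext r'') (ext-fusion h) n)
renameNf-fusion r r' r'' h (nsp x s) = cong₂ nsp (h x) (renameSp-fusion r r' r'' h s)
renameSp-fusion r r' r'' h []        = refl
renameSp-fusion r r' r'' h (n ∷ s)   =
  cong₂ _∷_ (renameNf-fusion r r' r'' h n) (renameSp-fusion r r' r'' h s)

renameNe-fusion : (r : Ren Γ Δ) (r' : Ren Δ Θ) (r'' : Ren Γ Θ) →
  (∀ {B} (x : Γ ∋ B) → r' (r x) ≡ r'' x) → (n : Ne Γ A) →
  renameNe r' (renameNe r n) ≡ renameNe r'' n
renameNe-fusion r r' r'' h (ne x s) = cong₂ ne (h x) (renameSp-fusion r r' r'' h s)

renameNf-id : (r : Ren Γ Γ) → (∀ {B} (x : Γ ∋ B) → r x ≡ x) → (n : Nf Γ A) → renameNf r n ≡ n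
renameSp-id : (r : Ren Γ Γ) → (∀ {B} (x : Γ ∋ B) → r x ≡ x) → (s : Sp Γ A C) → renameSp r s ≡ s
renameNf-id r h (nlam n)  = cong nlam (renameNf-id (ext r) (ext-id h) n)
renameNf-id r h (nsp x s) = cong₂ nsp (h x) (renameSp-id r h s)
renameSp-id r h []        = refl
renameSp-id r h (n ∷ s)   = cong₂ _∷_ (renameNf-id r h n) (renameSp-id r h s)

∷-++ˢ : (m : Nf Γ A) (s : Sp Γ B C) (t : Sp Γ C D) → (m ∷ s) ++ˢ t ≡ m ∷ (s ++ˢ t)
∷-++ˢ m s []      = refl
∷-++ˢ m s (n ∷ t) = ∷-++ˢ m (s ∷ʳ n) t

[]-++ˢ : (s : Sp Γ A B) → [] ++ˢ s ≡ s
[]-++ˢ []      = refl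
[]-++ˢ (n ∷ t) = trans (∷-++ˢ n [] t) (cong (n ∷_) ([]-++ˢ t))

⌜_⌝ : Nf Γ A → Tm Γ A
_$ˢ_ : Tm Γ A → Sp Γ A C → Tm Γ C
⌜ nlam n ⌝  = lam ⌜ n ⌝
⌜ nsp x s ⌝ = var x $ˢ s
h $ˢ []      = h
h $ˢ (n ∷ s) = app h ⌜ n ⌝ $ˢ s

⌜_⌝ⁿᵉ : Ne Γ A → Tm Γ A
⌜ ne x s ⌝ⁿᵉ = var x $ˢ s

$ˢ-∷ʳ : (h : Tm Γ A) (s : Sp Γ A (B ⇒ C)) (n : Nf Γ B) → h $ˢ (s ∷ʳ n) ≡ app (h $ˢ s) ⌜ n ⌝
$ˢ-∷ʳ h []      n = refl
$ˢ-∷ʳ h (m ∷ s) n = $ˢ-∷ʳ (app h ⌜ m ⌝) s n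

$ˢ-cong : {h h' : Tm Θ A} (s : Sp Θ A C) → h ≈ h' → h $ˢ s ≈ h' $ˢ s
$ˢ-cong []      q = q
$ˢ-cong (n ∷ s) q = $ˢ-cong s (app-cong q ≈refl)

⌜⌝-rename : (r : Ren Γ Δ) (n : Nf Γ A) → ⌜ renameNf r n ⌝ ≡ rename r ⌜ n ⌝
$ˢ-rename : (r : Ren Γ Δ) (h : Tm Γ A) (s : Sp Γ A C) →
  rename r h $ˢ renameSp r s ≡ rename r (h $ˢ s)
⌜⌝-rename r (nlam n)  = cong lam (⌜⌝-rename (ext r) n)
⌜⌝-rename r (nsp x s) = $ˢ-rename r (var x) s
$ˢ-rename r h []      = refl
$ˢ-rename r h (n ∷ s) =
  trans (cong (λ m → app (rename r h) m $ˢ renameSp r s) (⌜⌝-rename r n))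
        ($ˢ-rename r (app h ⌜ n ⌝) s)

⌜⌝ⁿᵉ-rename : (r : Ren Γ Δ) (n : Ne Γ A) → ⌜ renameNe r n ⌝ⁿᵉ ≡ rename r ⌜ n ⌝ⁿᵉ
⌜⌝ⁿᵉ-rename r (ne x s) = $ˢ-rename r (var x) s

⌜⌝ⁿᵉ-· : (n : Ne Γ (A ⇒ B)) (m : Nf Γ A) → ⌜ n · m ⌝ⁿᵉ ≡ app ⌜ n ⌝ⁿᵉ ⌜ m ⌝
⌜⌝ⁿᵉ-· (ne x s) m = $ˢ-∷ʳ (var x) s m

-- The Kripke model of partial equivalence relations

Sem : Ctx → Ty → Set
Sem Γ o       = Nf Γ o
Sem Γ (A ⇒ B) = ∀ {Δ} → Ren Γ Δ → Sem Δ A → Sem Δ B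

renameSem : Ren Γ Δ → Sem Γ A → Sem Δ A
renameSem {A = o}     r n = renameNf r n
renameSem {A = A ⇒ B} r f = λ r' → f (r' ∘ r)

reflect : Ne Γ A → Sem Γ A
reify   : Sem Γ A → Nf Γ A
reflect {A = o}     (ne x s) = nsp x s
reflect {A = A ⇒ B} n        = λ r a → reflect (renameNe r n · reify a)
reify {A = o}     n = n
reify {A = A ⇒ B} f = nlam (reify (f there (reflect (ne here []))))

SemEq : ∀ A → Sem Γ A → Sem Γ A → Set
syntax SemEq A a b = a ≋⟨ A ⟩ b
SemEq o n m           = n ≡ m
SemEq {Γ} (A ⇒ B) f g =
  (∀ {Δ} (r : Ren Γ Δ) {a b} → a ≋⟨ A ⟩ b → f r a ≋⟨ B ⟩ g r b) ×
  (∀ {Δ Θ} (r : Ren Γ Δ) (r' : Ren Δ Θ) {a b} → a ≋⟨ A ⟩ b →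
     renameSem r' (f r a) ≋⟨ B ⟩ g (r' ∘ r) (renameSem r' b))

≋-rename : ∀ A {a b : Sem Γ A} (r : Ren Γ Δ) → a ≋⟨ A ⟩ b → renameSem r a ≋⟨ A ⟩ renameSem r b
≋-rename o       r p         = cong (renameNf r) p
≋-rename (A ⇒ B) r (p₁ , p₂) = (λ r' → p₁ (r' ∘ r)) , (λ r' → p₂ (r' ∘ r))

≋-sym   : ∀ A {a b : Sem Γ A} → a ≋⟨ A ⟩ b → b ≋⟨ A ⟩ a
≋-trans : ∀ A {a b c : Sem Γ A} → a ≋⟨ A ⟩ b → b ≋⟨ A ⟩ c → a ≋⟨ A ⟩ c
≋-sym o p = sym p
≋-sym (A ⇒ B) (p₁ , p₂) =
  (λ r q → ≋-sym B (p₁ r (≋-sym A q))) ,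
  (λ r r' q →
     let q˘ = ≋-sym A q in
     ≋-trans B (≋-rename B r' (≋-sym B (p₁ r q˘)))
       (≋-trans B (p₂ r r' q˘) (≋-sym B (p₁ (r' ∘ r) (≋-rename A r' q˘)))))
≋-trans o p q = trans p q
≋-trans (A ⇒ B) (p₁ , p₂) (q₁ , _) =
  (λ r s → ≋-trans B (p₁ r (≋-trans A s (≋-sym A s))) (q₁ r s)) ,
  (λ r r' s → ≋-trans B (p₂ r r' (≋-trans A s (≋-sym A s))) (q₁ (r' ∘ r) (≋-rename A r' s)))

≋-reflˡ : ∀ A {a b : Sem Γ A} → a ≋⟨ A ⟩ b → a ≋⟨ A ⟩ a
≋-reflˡ A p = ≋-trans A p (≋-sym A p)

≋-reflʳ : ∀ A {a b : Sem Γ A} → a ≋⟨ A ⟩ b → b ≋⟨ A ⟩ b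
≋-reflʳ A p = ≋-trans A (≋-sym A p) p

≋-rename-fusion : ∀ A {a b : Sem Γ A} (r : Ren Γ Δ) (r' : Ren Δ Θ) → a ≋⟨ A ⟩ b →
  renameSem r' (renameSem r a) ≋⟨ A ⟩ renameSem (r' ∘ r) b
≋-rename-fusion o       r r' p = trans (renameNf-fusion r r' _ (λ _ → refl) _) (cong (renameNf _) p)
≋-rename-fusion (A ⇒ B) r r' p = ≋-rename (A ⇒ B) (r' ∘ r) p

≋-rename-id : ∀ A {a b : Sem Γ A} → a ≋⟨ A ⟩ b → renameSem id a ≋⟨ A ⟩ b
≋-rename-id o       p = trans (renameNf-id id (λ _ → refl) _) p
≋-rename-id (A ⇒ B) p = p

reify-≋        : ∀ A {a b : Sem Γ A} → a ≋⟨ A ⟩ b → reify a ≡ reify b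
reflect-≋      : ∀ A {n n' : Ne Γ A} → n ≡ n' → reflect n ≋⟨ A ⟩ reflect n'
reflect-rename : ∀ A (r : Ren Γ Δ) (n : Ne Γ A) →
  renameSem r (reflect n) ≋⟨ A ⟩ reflect (renameNe r n)
reify-rename   : ∀ A (r : Ren Γ Δ) {a : Sem Γ A} → a ≋⟨ A ⟩ a →
  renameNf r (reify a) ≡ reify (renameSem r a)
reflect-·-rename : ∀ A B (r : Ren Δ Θ) {n : Ne Δ (A ⇒ B)} {n' : Ne Θ (A ⇒ B)} {a b : Sem Δ A} →
  renameNe r n ≡ n' → a ≋⟨ A ⟩ b →
  renameSem r (reflect (n · reify a)) ≋⟨ B ⟩ reflect (n' · reify (renameSem r b))

reify-≋ o       p        = p
reify-≋ (A ⇒ B) (p₁ , _) = cong nlam (reify-≋ B (p₁ there (reflect-≋ A refl)))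

reflect-≋ o       {ne x s} refl = refl
reflect-≋ (A ⇒ B) {n}      refl =
  (λ r q → reflect-≋ B (cong (renameNe r n ·_) (reify-≋ A q))) ,
  (λ r r' q → reflect-·-rename A B r' (renameNe-fusion r r' _ (λ _ → refl) n) q)

reflect-rename o       r (ne x s) = refl
reflect-rename (A ⇒ B) r n        =
  (λ r₂ q → reflect-≋ B (cong₂ _·_ (sym (renameNe-fusion r r₂ _ (λ _ → refl) n)) (reify-≋ A q))) ,
  (λ r₂ r' q → reflect-·-rename A B r'
     (trans (renameNe-fusion _ r' _ (λ _ → refl) n) (sym (renameNe-fusion r _ _ (λ _ → refl) n))) q)

reflect-·-rename A B r {n} {a = a} n≡n' q =
  ≋-trans B (reflect-rename B r (n · reify a))
    (reflect-≋ B (trans (renameNe-· r n (reify a))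
      (cong₂ _·_ n≡n' (trans (reify-rename A r (≋-reflˡ A q)) (reify-≋ A (≋-rename A r q))))))

reify-rename o       r p         = refl
reify-rename (A ⇒ B) r (p₁ , p₂) =
  let v = reflect-≋ A {ne here []} refl in
  cong nlam (trans (reify-rename B (ext r) (p₁ there v))
    (trans (reify-≋ B (p₂ there (ext r) v))
      (reify-≋ B (p₁ (there ∘ r) (reflect-rename A (ext r) (ne here []))))))

-- Evaluation respects βη-conversion

Env : Ctx → Ctx → Set
Env Γ Δ = ∀ {A} → Γ ∋ A → Sem Δ A

_▸_ : Env Γ Δ → Sem Δ A → Env (A ∷ Γ) Δ
(γ ▸ a) here      = a
(γ ▸ a) (there x) = γ x

renameEnv : Ren Δ Θ → Env Γ Δ → Env Γ Θ
renameEnv r γ x = renameSem r (γ x)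

eval : Tm Γ A → Env Γ Δ → Sem Δ A
eval (var x)   γ = γ x
eval (lam t)   γ = λ r a → eval t (renameEnv r γ ▸ a)
eval (app t u) γ = eval t γ id (eval u γ)

infix 4 _≋ᴱ_
_≋ᴱ_ : Env Γ Δ → Env Γ Δ → Set
_≋ᴱ_ {Γ} γ γ' = ∀ {A} (x : Γ ∋ A) → γ x ≋⟨ A ⟩ γ' x

≋ᴱ-▸ : {γ γ' : Env Γ Δ} {a b : Sem Δ A} → γ ≋ᴱ γ' → a ≋⟨ A ⟩ b → (γ ▸ a) ≋ᴱ (γ' ▸ b)
≋ᴱ-▸ p q here      = q
≋ᴱ-▸ p q (there x) = p x

≋ᴱ-sym : {γ γ' : Env Γ Δ} → γ ≋ᴱ γ' → γ' ≋ᴱ γ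
≋ᴱ-sym p x = ≋-sym _ (p x)

≋ᴱ-reflˡ : {γ γ' : Env Γ Δ} → γ ≋ᴱ γ' → γ ≋ᴱ γ
≋ᴱ-reflˡ p x = ≋-reflˡ _ (p x)

≋ᴱ-reflʳ : {γ γ' : Env Γ Δ} → γ ≋ᴱ γ' → γ' ≋ᴱ γ'
≋ᴱ-reflʳ p x = ≋-reflʳ _ (p x)

≋ᴱ-rename : {γ γ' : Env Γ Δ} (r : Ren Δ Θ) → γ ≋ᴱ γ' → renameEnv r γ ≋ᴱ renameEnv r γ'
≋ᴱ-rename r p x = ≋-rename _ r (p x)

eval-lam-≋ : (t t' : Tm (A ∷ Γ) B) →
  (∀ {Δ} {γ γ' : Env (A ∷ Γ) Δ} → γ ≋ᴱ γ' → eval t γ ≋⟨ B ⟩ eval t' γ') →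
  (∀ {Δ Θ} {γ γ' : Env (A ∷ Γ) Δ} (r : Ren Δ Θ) → γ ≋ᴱ γ' →
     renameSem r (eval t γ) ≋⟨ B ⟩ eval t (renameEnv r γ')) →
  {γ γ' : Env Γ Δ} → γ ≋ᴱ γ' → eval (lam t) γ ≋⟨ A ⇒ B ⟩ eval (lam t') γ'
eval-lam-≋ {A = A} {B = B} t t' t≋t' t-natural {γ' = γ'} p =
  (λ r q → t≋t' (≋ᴱ-▸ (≋ᴱ-rename r p) q)) ,
  (λ r r' q →
    ≋-trans B (t-natural r' (≋ᴱ-▸ (≋ᴱ-rename r p) q))
      (t≋t' (env r r' (≋-reflʳ A q))))
  where
  env : ∀ {Δ' Θ'} (r : Ren _ Δ') (r' : Ren Δ' Θ') {b} → b ≋⟨ A ⟩ b →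
    renameEnv r' (renameEnv r γ' ▸ b) ≋ᴱ (renameEnv (r' ∘ r) γ' ▸ renameSem r' b)
  env r r' q here      = ≋-rename A r' q
  env r r' q (there x) = ≋-rename-fusion _ r r' (≋-reflʳ _ (p x))

eval-≋       : (t : Tm Γ A) {γ γ' : Env Γ Δ} → γ ≋ᴱ γ' → eval t γ ≋⟨ A ⟩ eval t γ'
eval-natural : (t : Tm Γ A) {γ γ' : Env Γ Δ} (r : Ren Δ Θ) → γ ≋ᴱ γ' →
  renameSem r (eval t γ) ≋⟨ A ⟩ eval t (renameEnv r γ')
eval-≋ (var x)   p = p x
eval-≋ (lam t)   p = eval-lam-≋ t t (eval-≋ t) (eval-natural t) p
eval-≋ (app t u) p = proj₁ (eval-≋ t p) id (eval-≋ u p)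

eval-natural (var x) r p = ≋-rename _ r (p x)
eval-natural {A = B} (app t u) r p =
  ≋-trans B (proj₂ (eval-≋ t (≋ᴱ-reflˡ p)) id r (eval-≋ u (≋ᴱ-reflˡ p)))
    (proj₁ (eval-natural t r p) id (eval-natural u r p))
eval-natural (lam {A = A} {B = B} t) {γ' = γ'} r p =
  (λ r₂ q → eval-≋ t (≋ᴱ-▸ (λ x → ≋-sym _ (≋-rename-fusion _ r r₂ (≋-sym _ (p x)))) q)) ,
  (λ r₂ r' q →
    ≋-trans B (eval-natural t r' (≋ᴱ-▸ (≋ᴱ-rename (r₂ ∘ r) p) q))
      (eval-≋ t (env r₂ r' (≋-reflʳ A q))))
  where
  env : ∀ {Δ' Θ'} (r₂ : Ren _ Δ') (r' : Ren Δ' Θ') {b} → b ≋⟨ A ⟩ b →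
    renameEnv r' (renameEnv (r₂ ∘ r) γ' ▸ b)
      ≋ᴱ (renameEnv (r' ∘ r₂) (renameEnv r γ') ▸ renameSem r' b)
  env r₂ r' q here      = ≋-rename A r' q
  env r₂ r' q (there x) =
    ≋-trans _ (≋-rename-fusion _ (r₂ ∘ r) r' (≋-reflʳ _ (p x)))
      (≋-sym _ (≋-rename-fusion _ r (r' ∘ r₂) (≋-reflʳ _ (p x))))

eval-rename : (t : Tm Γ A) (ρ : Ren Γ Θ) {γ γ' : Env Θ Δ} → γ ≋ᴱ γ' →
  eval (rename ρ t) γ ≋⟨ A ⟩ eval t (γ' ∘ ρ)
eval-rename (var x)   ρ p = p (ρ x)
eval-rename (app t u) ρ p = proj₁ (eval-rename t ρ p) id (eval-rename u ρ p)
eval-rename (lam {A = A} {B = B} t) ρ {γ' = γ'} p =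
  (λ r q → ≋-trans B (eval-rename t (ext ρ) (≋ᴱ-▸ (≋ᴱ-rename r p) q))
             (eval-≋ t (env r (≋-reflʳ A q)))) ,
  (λ r r' q →
    ≋-trans B (eval-natural (rename (ext ρ) t) r' (≋ᴱ-▸ (≋ᴱ-rename r p) q))
      (≋-trans B (eval-rename t (ext ρ) (≋ᴱ-reflʳ (≋ᴱ-rename r' (≋ᴱ-▸ (≋ᴱ-rename r p) q))))
        (eval-≋ t (env₂ r r' (≋-reflʳ A q)))))
  where
  env : ∀ {Δ'} (r : Ren _ Δ') {b} → b ≋⟨ A ⟩ b →
    ((renameEnv r γ' ▸ b) ∘ ext ρ) ≋ᴱ (renameEnv r (γ' ∘ ρ) ▸ b)
  env r q here      = q
  env r q (there x) = ≋-rename _ r (≋-reflʳ _ (p (ρ x)))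
  env₂ : ∀ {Δ' Θ'} (r : Ren _ Δ') (r' : Ren Δ' Θ') {b} → b ≋⟨ A ⟩ b →
    (renameEnv r' (renameEnv r γ' ▸ b) ∘ ext ρ) ≋ᴱ (renameEnv (r' ∘ r) (γ' ∘ ρ) ▸ renameSem r' b)
  env₂ r r' q here      = ≋-rename A r' q
  env₂ r r' q (there x) = ≋-rename-fusion _ r r' (≋-reflʳ _ (p (ρ x)))

eval-subst : (t : Tm Γ A) (σ : Sub Γ Θ) {γ γ' : Env Θ Δ} → γ ≋ᴱ γ' →
  eval (subst σ t) γ ≋⟨ A ⟩ eval t (λ x → eval (σ x) γ')
eval-subst (var x)   σ p = eval-≋ (σ x) p
eval-subst (app t u) σ p = proj₁ (eval-subst t σ p) id (eval-subst u σ p)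
eval-subst (lam {A = A} {B = B} t) σ {γ' = γ'} p =
  (λ r q → ≋-trans B (eval-subst t (exts σ) (≋ᴱ-▸ (≋ᴱ-rename r p) q))
             (eval-≋ t (env r (≋-reflʳ A q)))) ,
  (λ r r' q →
    ≋-trans B (eval-natural (subst (exts σ) t) r' (≋ᴱ-▸ (≋ᴱ-rename r p) q))
      (≋-trans B (eval-subst t (exts σ) (≋ᴱ-reflʳ (≋ᴱ-rename r' (≋ᴱ-▸ (≋ᴱ-rename r p) q))))
        (eval-≋ t (env₂ r r' (≋-reflʳ A q)))))
  where
  γ'≋γ' : γ' ≋ᴱ γ'
  γ'≋γ' = ≋ᴱ-reflʳ p
  env : ∀ {Δ'} (r : Ren _ Δ') {b} → b ≋⟨ A ⟩ b →
    (λ x → eval (exts σ x) (renameEnv r γ' ▸ b)) ≋ᴱ (renameEnv r (λ x → eval (σ x) γ') ▸ b)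
  env r q here      = q
  env r q (there x) =
    ≋-trans _ (eval-rename (σ x) there (≋ᴱ-▸ (≋ᴱ-rename r γ'≋γ') q))
      (≋-sym _ (eval-natural (σ x) r γ'≋γ'))
  env₂ : ∀ {Δ' Θ'} (r : Ren _ Δ') (r' : Ren Δ' Θ') {b} → b ≋⟨ A ⟩ b →
    (λ x → eval (exts σ x) (renameEnv r' (renameEnv r γ' ▸ b)))
      ≋ᴱ (renameEnv (r' ∘ r) (λ x → eval (σ x) γ') ▸ renameSem r' b)
  env₂ r r' q here      = ≋-rename A r' q
  env₂ r r' q (there x) =
    ≋-trans _ (eval-rename (σ x) there (≋ᴱ-rename r' (≋ᴱ-▸ (≋ᴱ-rename r γ'≋γ') q)))
      (≋-trans _ (eval-≋ (σ x) (λ y → ≋-rename-fusion _ r r' (γ'≋γ' y)))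
        (≋-sym _ (eval-natural (σ x) (r' ∘ r) γ'≋γ')))

≈⇒eval-≋ : {t u : Tm Γ A} → t ≈ u → {γ γ' : Env Γ Δ} → γ ≋ᴱ γ' → eval t γ ≋⟨ A ⟩ eval u γ'
≈⇒eval-≋ {t = t} ≈refl p = eval-≋ t p
≈⇒eval-≋ (≈sym q)       p = ≋-sym _ (≈⇒eval-≋ q (≋ᴱ-sym p))
≈⇒eval-≋ (≈trans q q')  p = ≋-trans _ (≈⇒eval-≋ q (≋ᴱ-reflˡ p)) (≈⇒eval-≋ q' p)
≈⇒eval-≋ (lam-cong {t = t} {t' = t'} q) p = eval-lam-≋ t t' (≈⇒eval-≋ q) (eval-natural t) p
≈⇒eval-≋ (app-cong q q') p = proj₁ (≈⇒eval-≋ q p) id (≈⇒eval-≋ q' p)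
≈⇒eval-≋ {A = B} (β t u) {γ} {γ'} p =
  ≋-trans B (eval-≋ t env) (≋-sym B (eval-subst t (σ₀ u) (≋ᴱ-reflʳ p)))
  where
  env : (renameEnv id γ ▸ eval u γ) ≋ᴱ (λ x → eval (σ₀ u x) γ')
  env here      = eval-≋ u p
  env (there x) = ≋-rename-id _ (p x)
≈⇒eval-≋ {A = A ⇒ B} (η t) {γ' = γ'} p =
  (λ r q → ≋-trans B (proj₁ (eval-natural t r p) id q) (η-body r (≋-reflʳ A q))) ,
  (λ r r' q →
    let q' = ≋-rename A r' q in
    ≋-trans B (proj₂ (eval-≋ t (≋ᴱ-reflˡ p)) r r' (≋-reflˡ A q))
      (≋-trans B (proj₁ (eval-natural t (r' ∘ r) p) id q') (η-body (r' ∘ r) (≋-reflʳ A q'))))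
  where
  η-body : ∀ {Θ} (r : Ren _ Θ) {a} → a ≋⟨ A ⟩ a →
    eval t (renameEnv r γ') id a ≋⟨ B ⟩ eval (rename there t) (renameEnv r γ' ▸ a) id a
  η-body r q = proj₁ (≋-sym _ (eval-rename t there (≋ᴱ-▸ (≋ᴱ-rename r (≋ᴱ-reflʳ p)) q))) id q

-- Soundness of normalisation

Realizes : ∀ A → Tm Γ A → Sem Γ A → Set
syntax Realizes A t a = t ⓡ⟨ A ⟩ a
Realizes o       t n = t ≈ ⌜ n ⌝
Realizes {Γ} (A ⇒ B) t f =
  ∀ {Δ} (r : Ren Γ Δ) {u a} → u ⓡ⟨ A ⟩ a → app (rename r t) u ⓡ⟨ B ⟩ f r a

ⓡ-≈ : ∀ A {t t' : Tm Γ A} {a} → t ≈ t' → t ⓡ⟨ A ⟩ a → t' ⓡ⟨ A ⟩ a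
ⓡ-≈ o       q l = ≈trans (≈sym q) l
ⓡ-≈ (A ⇒ B) q l = λ r l' → ⓡ-≈ B (app-cong (rename-≈ r q) ≈refl) (l r l')

ⓡ-rename : ∀ A {t : Tm Γ A} {a} (r : Ren Γ Δ) → t ⓡ⟨ A ⟩ a → rename r t ⓡ⟨ A ⟩ renameSem r a
ⓡ-rename o       {a = n} r l = ≈trans (rename-≈ r l) (≡⇒≈ (sym (⌜⌝-rename r n)))
ⓡ-rename (A ⇒ B) {t}     r l = λ r₂ l' →
  ⓡ-≈ B (app-cong (≡⇒≈ (sym (rename-fusion r r₂ _ (λ _ → refl) t))) ≈refl) (l (r₂ ∘ r) l')

reflect-ⓡ : ∀ A {t : Tm Γ A} (n : Ne Γ A) → t ≈ ⌜ n ⌝ⁿᵉ → t ⓡ⟨ A ⟩ reflect n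
reify-ⓡ   : ∀ A {t : Tm Γ A} {a} → t ⓡ⟨ A ⟩ a → t ≈ ⌜ reify a ⌝
reflect-ⓡ o       (ne x s) q = q
reflect-ⓡ (A ⇒ B) n        q = λ r {a = a} l →
  reflect-ⓡ B (renameNe r n · reify a)
    (≈trans (app-cong (≈trans (rename-≈ r q) (≡⇒≈ (sym (⌜⌝ⁿᵉ-rename r n)))) (reify-ⓡ A l))
            (≡⇒≈ (sym (⌜⌝ⁿᵉ-· (renameNe r n) (reify a)))))
reify-ⓡ o       l = l
reify-ⓡ (A ⇒ B) {t} l =
  ≈trans (η t) (lam-cong (reify-ⓡ B (l there (reflect-ⓡ A (ne here []) ≈refl))))

fundamental : (t : Tm Γ A) (σ : Sub Γ Δ) (γ : Env Γ Δ) →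
  (∀ {B} (x : Γ ∋ B) → σ x ⓡ⟨ B ⟩ γ x) → subst σ t ⓡ⟨ A ⟩ eval t γ
fundamental (var x) σ γ p = p x
fundamental (app {B = B} t u) σ γ p =
  ⓡ-≈ B (app-cong (≡⇒≈ (rename-id id (λ _ → refl) (subst σ t))) ≈refl)
    (fundamental t σ γ p id (fundamental u σ γ p))
fundamental {Γ = Γ} {Δ = Δ} (lam {A = A} {B = B} t) σ γ p = λ r {u} {a} l →
  ⓡ-≈ B (≈sym (≈trans (β _ u) (≡⇒≈ (subst-β r u))))
    (fundamental t (σ′ r u) (renameEnv r γ ▸ a) (σ′ⓡ r l))
  where
  σ′ : ∀ {Δ'} → Ren Δ Δ' → Tm Δ' A → Sub (A ∷ Γ) Δ'
  σ′ r u here      = u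
  σ′ r u (there x) = rename r (σ x)
  σ′ⓡ : ∀ {Δ'} (r : Ren Δ Δ') {u a} → u ⓡ⟨ A ⟩ a →
    ∀ {B} (x : (A ∷ Γ) ∋ B) → σ′ r u x ⓡ⟨ B ⟩ (renameEnv r γ ▸ a) x
  σ′ⓡ r l here      = l
  σ′ⓡ r l (there x) = ⓡ-rename _ r (p x)
  subst-β : ∀ {Δ'} (r : Ren Δ Δ') (u : Tm Δ' A) →
    rename (ext r) (subst (exts σ) t) [ u ] ≡ subst (σ′ r u) t
  subst-β r u =
    trans (cong (subst (σ₀ u))
                (rename-subst (ext r) (exts σ) (rename (ext r) ∘ exts σ) (λ _ → refl) t))
          (subst-fusion _ (σ₀ u) (σ′ r u) h t)
    where
    h : ∀ {B} (x : (A ∷ Γ) ∋ B) → rename (ext r) (exts σ x) [ u ] ≡ σ′ r u x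
    h here      = refl
    h (there x) =
      trans (cong (subst (σ₀ u)) (rename-fusion there (ext r) (there ∘ r) (λ _ → refl) (σ x)))
        (trans (subst-rename (there ∘ r) (σ₀ u) (var ∘ r) (λ _ → refl) (σ x))
               (subst-var (var ∘ r) r (λ _ → refl) (σ x)))

varEnv : Ren Γ Δ → Env Γ Δ
varEnv r x = reflect (ne (r x) [])

nf : Tm Γ A → Nf Γ A
nf t = reify (eval t (varEnv id))

nf-sound : (t : Tm Γ A) → t ≈ ⌜ nf t ⌝
nf-sound {A = A} t = reify-ⓡ A (ⓡ-≈ A (≡⇒≈ (subst-id t))
  (fundamental t var (varEnv id) (λ x → reflect-ⓡ _ (ne x []) ≈refl)))

-- Normal forms decide βη-conversion

varEnv-≋ : (r : Ren Γ Δ) → varEnv r ≋ᴱ varEnv r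
varEnv-≋ r x = reflect-≋ _ refl

eval-⌜⌝ : (n : Nf Γ A) (r : Ren Γ Δ) → reify (eval ⌜ n ⌝ (varEnv r)) ≡ renameNf r n
eval-$ˢ : (r : Ren Γ Δ) (h : Tm Γ A) (s : Sp Γ A C) {y : Δ ∋ B} {s₀ : Sp Δ B A} →
  eval h (varEnv r) ≋⟨ A ⟩ reflect (ne y s₀) →
  eval (h $ˢ s) (varEnv r) ≋⟨ C ⟩ reflect (ne y (s₀ ++ˢ renameSp r s))
eval-$ˢ r h []                           p = p
eval-$ˢ r h (_∷_ {B = B} n s) {y} {s₀} p =
  eval-$ˢ r (app h ⌜ n ⌝) s
    (≋-trans B (proj₁ p id (eval-≋ ⌜ n ⌝ (varEnv-≋ r)))
      (reflect-≋ B (cong₂ (λ s' m → ne y (s' ∷ʳ m))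
                          (renameSp-id id (λ _ → refl) s₀) (eval-⌜⌝ n r))))
eval-⌜⌝ (nsp x s) r =
  trans (eval-$ˢ r (var x) s {s₀ = []} (reflect-≋ _ refl))
        (cong (nsp (r x)) ([]-++ˢ (renameSp r s)))
eval-⌜⌝ (nlam {A = A} n) r = cong nlam (trans (reify-≋ _ (eval-≋ ⌜ n ⌝ env)) (eval-⌜⌝ n (ext r)))
  where
  env : (renameEnv there (varEnv r) ▸ reflect (ne here [])) ≋ᴱ varEnv (ext r)
  env here      = reflect-≋ A refl
  env (there x) = reflect-rename _ there (ne (r x) [])

nf-⌜⌝ : (n : Nf Γ A) → nf ⌜ n ⌝ ≡ n
nf-⌜⌝ n = trans (eval-⌜⌝ n id) (renameNf-id id (λ _ → refl) n)

nf-complete : {t u : Tm Γ A} → t ≈ u → nf t ≡ nf u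
nf-complete q = reify-≋ _ (≈⇒eval-≋ q (varEnv-≋ id))

nf-unique : {t : Tm Γ A} (n : Nf Γ A) → t ≈ ⌜ n ⌝ → nf t ≡ n
nf-unique n q = trans (nf-complete q) (nf-⌜⌝ n)

nf-injective : (t u : Tm Γ A) → nf t ≡ nf u → t ≈ u
nf-injective t u e = ≈trans (nf-sound t) (≈trans (≡⇒≈ (cong ⌜_⌝ e)) (≈sym (nf-sound u)))

nfArgs : Args Θ A → Sp Θ A o
nfArgs {A = o}     tt       = []
nfArgs {A = A ⇒ B} (M , Ms) = nf M ∷ nfArgs Ms

apps-$ˢ : (h : Tm Θ A) (Ms : Args Θ A) → apps h Ms ≈ h $ˢ nfArgs Ms
apps-$ˢ {A = o}     h tt       = ≈refl
apps-$ˢ {A = A ⇒ B} h (M , Ms) =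
  ≈trans (apps-$ˢ (app h M) Ms) ($ˢ-cong (nfArgs Ms) (app-cong ≈refl (nf-sound M)))

∷-injectiveˡ : {m n : Nf Γ A} {s t : Sp Γ B C} → m ∷ s ≡ n ∷ t → m ≡ n
∷-injectiveˡ refl = refl

∷-injectiveʳ : {m n : Nf Γ A} {s t : Sp Γ B C} → m ∷ s ≡ n ∷ t → s ≡ t
∷-injectiveʳ refl = refl

nfArgs-injective : ∀ A (Ms Ns : Args Θ A) → nfArgs Ms ≡ nfArgs Ns → ArgsEq A Ms Ns
nfArgs-injective o       tt       tt       e = tt
nfArgs-injective (A ⇒ B) (M , Ms) (N , Ns) e =
  nf-injective M N (∷-injectiveˡ e) , nfArgs-injective B Ms Ns (∷-injectiveʳ e)

apps-var-injective : (z : Θ ∋ B) (Ms : Args Θ B) (w : Θ ∋ C) (Ns : Args Θ C) →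
  apps (var z) Ms ≈ apps (var w) Ns → SameHeadArgs z Ms w Ns
apps-var-injective {Θ = Θ} {B = B} {C = C} z Ms w Ns e =
  heads (trans (sym (nf-unique _ (apps-$ˢ (var z) Ms))) (nf-unique _ (≈trans e (apps-$ˢ (var w) Ns))))
    refl refl
  where
  heads : {s : Sp Θ B o} {t : Sp Θ C o} →
    nsp z s ≡ nsp w t → s ≡ nfArgs Ms → t ≡ nfArgs Ns → SameHeadArgs z Ms w Ns
  heads refl refl e = same (nfArgs-injective _ Ms Ns e)

-- Jointly injective renamings

Var : Ctx → Set
Var Γ = ∃ (Γ ∋_)

⟪_⟫ : Γ ∋ A → Var Γ
⟪ x ⟫ = _ , x

⟪⟫-injective : {x y : Γ ∋ A} → ⟪ x ⟫ ≡ ⟪ y ⟫ → x ≡ y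
⟪⟫-injective refl = refl

⟪there⟫-injective : {x : Γ ∋ A} {y : Γ ∋ B} → ⟪ there {B = C} x ⟫ ≡ ⟪ there y ⟫ → ⟪ x ⟫ ≡ ⟪ y ⟫
⟪there⟫-injective refl = refl

⟪there⟫-cong : {x : Γ ∋ A} {y : Γ ∋ B} → ⟪ x ⟫ ≡ ⟪ y ⟫ → ⟪ there {B = C} x ⟫ ≡ ⟪ there y ⟫
⟪there⟫-cong refl = refl

JointlyInjective : Ren Γ Δ → Ren Γ Δ → Set
JointlyInjective {Γ} r₁ r₂ = ∀ {A B} (x : Γ ∋ A) (y : Γ ∋ B) →
  ⟪ r₁ x ⟫ ≡ ⟪ r₁ y ⟫ → ⟪ r₂ x ⟫ ≡ ⟪ r₂ y ⟫ → ⟪ x ⟫ ≡ ⟪ y ⟫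

ext-jointly-injective : {r₁ r₂ : Ren Γ Δ} → JointlyInjective r₁ r₂ →
  JointlyInjective (ext {B = C} r₁) (ext r₂)
ext-jointly-injective J here      here      e₁ e₂ = refl
ext-jointly-injective J (there x) (there y) e₁ e₂ =
  ⟪there⟫-cong (J x y (⟪there⟫-injective e₁) (⟪there⟫-injective e₂))

nlam-injective : {m n : Nf (A ∷ Γ) B} → nlam m ≡ nlam n → m ≡ n
nlam-injective refl = refl

nsp-injectiveˡ : {z : Γ ∋ A} {w : Γ ∋ B} {s : Sp Γ A o} {t : Sp Γ B o} →
  nsp z s ≡ nsp w t → ⟪ z ⟫ ≡ ⟪ w ⟫
nsp-injectiveˡ refl = refl

nsp-injectiveʳ : {z : Γ ∋ A} {s t : Sp Γ A o} → nsp z s ≡ nsp z t → s ≡ t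
nsp-injectiveʳ refl = refl

renameNf-jointly-injective : {r₁ r₂ : Ren Γ Δ} → JointlyInjective r₁ r₂ → (m n : Nf Γ C) →
  renameNf r₁ m ≡ renameNf r₁ n → renameNf r₂ m ≡ renameNf r₂ n → m ≡ n
renameSp-jointly-injective : {r₁ r₂ : Ren Γ Δ} → JointlyInjective r₁ r₂ → (s t : Sp Γ A o) →
  renameSp r₁ s ≡ renameSp r₁ t → renameSp r₂ s ≡ renameSp r₂ t → s ≡ t
renameNf-jointly-injective J (nlam m) (nlam n) e₁ e₂ =
  cong nlam (renameNf-jointly-injective (ext-jointly-injective J) m n
                                        (nlam-injective e₁) (nlam-injective e₂))
renameNf-jointly-injective {Γ = Γ} {r₁ = r₁} {r₂} J (nsp x s) (nsp y t) e₁ e₂ =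
  spines (J x y (nsp-injectiveˡ e₁) (nsp-injectiveˡ e₂)) t e₁ e₂
  where
  spines : ∀ {B} {y : Γ ∋ B} → ⟪ x ⟫ ≡ ⟪ y ⟫ → (t : Sp Γ B o) →
    renameNf r₁ (nsp x s) ≡ renameNf r₁ (nsp y t) → renameNf r₂ (nsp x s) ≡ renameNf r₂ (nsp y t) →
    nsp x s ≡ nsp y t
  spines refl t e₁ e₂ =
    cong (nsp x) (renameSp-jointly-injective J s t (nsp-injectiveʳ e₁) (nsp-injectiveʳ e₂))
renameSp-jointly-injective J []      []      e₁ e₂ = refl
renameSp-jointly-injective J (n ∷ s) (m ∷ t) e₁ e₂ =
  cong₂ _∷_ (renameNf-jointly-injective J n m (∷-injectiveˡ e₁) (∷-injectiveˡ e₂))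
            (renameSp-jointly-injective J s t (∷-injectiveʳ e₁) (∷-injectiveʳ e₂))

body : Nf Γ (A ⇒ B) → Nf (A ∷ Γ) B
body (nlam n) = n

nlam-body : (n : Nf Γ (A ⇒ B)) → nlam (body n) ≡ n
nlam-body (nlam n) = refl

_↦_ : ∀ A → Θ ∋ A → Ren (A ∷ Θ) Θ
(A ↦ u) here      = u
(A ↦ u) (there x) = x

↦-jointly-injective : {u v : Θ ∋ A} → u ≢ v → JointlyInjective (A ↦ u) (A ↦ v)
↦-jointly-injective u≢v here      here      e₁ e₂ = refl
↦-jointly-injective u≢v here      (there y) e₁ e₂ = ⊥-elim (u≢v (⟪⟫-injective (trans e₁ (sym e₂))))
↦-jointly-injective u≢v (there x) here      e₁ e₂ = ⊥-elim (u≢v (⟪⟫-injective (trans (sym e₁) e₂)))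
↦-jointly-injective u≢v (there x) (there y) e₁ e₂ = ⟪there⟫-cong e₁

nf-app-var : (M : Tm Θ (A ⇒ B)) (u : Θ ∋ A) → nf (app M (var u)) ≡ renameNf (A ↦ u) (body (nf M))
nf-app-var {Θ = Θ} {A = A} M u = nf-unique _ (begin
  app M (var u)                          ≈⟨ app-cong (nf-sound M) ≈refl ⟩
  app ⌜ nf M ⌝ (var u)                   ≡⟨ cong (λ n → app ⌜ n ⌝ (var u)) (sym (nlam-body (nf M))) ⟩
  app (lam ⌜ body (nf M) ⌝) (var u)      ≈⟨ β _ _ ⟩
  ⌜ body (nf M) ⌝ [ var u ]              ≡⟨ subst-var (σ₀ (var u)) (A ↦ u) σ₀≡↦ _ ⟩
  rename (A ↦ u) ⌜ body (nf M) ⌝         ≡⟨ sym (⌜⌝-rename (A ↦ u) (body (nf M))) ⟩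
  ⌜ renameNf (A ↦ u) (body (nf M)) ⌝     ∎)
  where
  open ≈-Reasoning
  σ₀≡↦ : ∀ {B} (x : (A ∷ Θ) ∋ B) → σ₀ (var u) x ≡ var ((A ↦ u) x)
  σ₀≡↦ here      = refl
  σ₀≡↦ (there x) = refl

app-var-injective : (M N : Tm Θ (A ⇒ B)) {u v : Θ ∋ A} → u ≢ v →
  app M (var u) ≈ app N (var u) → app M (var v) ≈ app N (var v) → M ≈ N
app-var-injective {A = A} M N {u} {v} u≢v eu ev = nf-injective M N (begin
  nf M                   ≡⟨ sym (nlam-body (nf M)) ⟩
  nlam (body (nf M))     ≡⟨ cong nlam bodies ⟩
  nlam (body (nf N))     ≡⟨ nlam-body (nf N) ⟩
  nf N                   ∎)
  where
  open ≡-Reasoning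
  at : ∀ w → app M (var w) ≈ app N (var w) →
    renameNf (A ↦ w) (body (nf M)) ≡ renameNf (A ↦ w) (body (nf N))
  at w e = trans (sym (nf-app-var M w)) (trans (nf-complete e) (nf-app-var N w))
  bodies : body (nf M) ≡ body (nf N)
  bodies = renameNf-jointly-injective (↦-jointly-injective u≢v) _ _ (at u eu) (at v ev)

-- The atomic reduction

same-head : {a : Θ ∋ A} {b : Θ ∋ B} {Ms : Args Δ A} {Ns : Args Δ B} →
  SameHeadArgs a Ms b Ns → ⟪ a ⟫ ≡ ⟪ b ⟫
same-head (same _) = refl

same-args : {a : Θ ∋ A} {Ms Ns : Args Δ A} → SameHeadArgs a Ms a Ns → ArgsEq A Ms Ns
same-args (same e) = e

_↑ˡ_ : Ξ ∋ A → ∀ Θ → (Ξ ++ Θ) ∋ A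
here    ↑ˡ Θ = here
there x ↑ˡ Θ = there (x ↑ˡ Θ)

_↑ʳ_ : ∀ Ξ → Θ ∋ A → (Ξ ++ Θ) ∋ A
[]      ↑ʳ y = y
(C ∷ Ξ) ↑ʳ y = there (Ξ ↑ʳ y)

data Split (Ξ : Ctx) {Θ : Ctx} {A : Ty} : (Ξ ++ Θ) ∋ A → Set where
  isˡ : (x : Ξ ∋ A) → Split Ξ (x ↑ˡ Θ)
  isʳ : (y : Θ ∋ A) → Split Ξ (Ξ ↑ʳ y)

split : ∀ Ξ (a : (Ξ ++ Θ) ∋ A) → Split Ξ a
split []      a         = isʳ a
split (C ∷ Ξ) here      = isˡ here
split (C ∷ Ξ) (there a) with split Ξ a
... | isˡ x = isˡ (there x)
... | isʳ y = isʳ y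

↑ˡ≢↑ʳ : (x : Ξ ∋ A) (y : Θ ∋ B) → ⟪ x ↑ˡ Θ ⟫ ≢ ⟪ Ξ ↑ʳ y ⟫
↑ˡ≢↑ʳ here      y ()
↑ˡ≢↑ʳ (there x) y e = ↑ˡ≢↑ʳ x y (⟪there⟫-injective e)

↑ˡ-injective : (x : Ξ ∋ A) (y : Ξ ∋ B) → ⟪ x ↑ˡ Θ ⟫ ≡ ⟪ y ↑ˡ Θ ⟫ → ⟪ x ⟫ ≡ ⟪ y ⟫
↑ˡ-injective here      here      e = refl
↑ˡ-injective (there x) (there y) e = ⟪there⟫-cong (↑ˡ-injective x y (⟪there⟫-injective e))

SameHeadArgs-↑ˡ : (x : Ξ ∋ A) (y : Ξ ∋ B) {Ms : Args Δ A} {Ns : Args Δ B} →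
  SameHeadArgs (x ↑ˡ Θ) Ms (y ↑ˡ Θ) Ns → SameHeadArgs (x ↑ˡ Γ) Ms (y ↑ˡ Γ) Ns
SameHeadArgs-↑ˡ {Ξ = Ξ} {Δ = Δ} {Θ = Θ} {Γ = Γ} x y {Ms} h =
  reindex y (↑ˡ-injective x y (same-head h)) h
  where
  reindex : ∀ {B} (y : Ξ ∋ B) {Ns : Args Δ B} → ⟪ x ⟫ ≡ ⟪ y ⟫ →
    SameHeadArgs (x ↑ˡ Θ) Ms (y ↑ˡ Θ) Ns → SameHeadArgs (x ↑ˡ Γ) Ms (y ↑ˡ Γ) Ns
  reindex .x refl h = same (same-args h)

there-injective : {x y : Γ ∋ A} → there {B = B} x ≡ there y → x ≡ y
there-injective refl = refl

↑ʳ-injective : ∀ Ξ {y y' : Θ ∋ A} → Ξ ↑ʳ y ≡ Ξ ↑ʳ y' → y ≡ y'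
↑ʳ-injective []      e = e
↑ʳ-injective (C ∷ Ξ) e = ↑ʳ-injective Ξ (there-injective e)

liftCtx-↑ˡ : ∀ Ξ (ϱ : Sub Γ Δ) (x : Ξ ∋ A) → liftCtx Ξ ϱ (x ↑ˡ Γ) ≡ var (x ↑ˡ Δ)
liftCtx-↑ˡ (C ∷ Ξ) ϱ here      = refl
liftCtx-↑ˡ (C ∷ Ξ) ϱ (there x) = cong (rename there) (liftCtx-↑ˡ Ξ ϱ x)

liftCtx-↑ʳ : ∀ Ξ (ϱ : Sub Γ Δ) (y : Γ ∋ A) → liftCtx Ξ ϱ (Ξ ↑ʳ y) ≡ rename (Ξ ↑ʳ_) (ϱ y)
liftCtx-↑ʳ []      ϱ y = sym (rename-id id (λ _ → refl) (ϱ y))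
liftCtx-↑ʳ (C ∷ Ξ) ϱ y =
  trans (cong (rename there) (liftCtx-↑ʳ Ξ ϱ y))
        (rename-fusion (Ξ ↑ʳ_) there ((C ∷ Ξ) ↑ʳ_) (λ _ → refl) (ϱ y))

Γ₀ : Ty → Ctx
Γ₀ A = ((A ⇒ o) ⇒ o) ∷ []

Δ₀ : Ty → Ctx
Δ₀ A = (o ⇒ o ⇒ o) ∷ A ∷ A ∷ []

p₀ : Δ₀ A ∋ o ⇒ o ⇒ o
p₀ = here

u₀ v₀ : Δ₀ A ∋ A
u₀ = there here
v₀ = there (there here)

-- x ↦ λ f. p (f u) (f v)
ϱ : ∀ A → Sub (Γ₀ A) (Δ₀ A)
ϱ A here = lam (app (app (var (there p₀)) (app (var here) (var (there u₀))))
                    (app (var here) (var (there v₀))))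

ϱ-↑ʳ : ∀ Ξ (N : Tm (Ξ ++ Δ₀ A) (A ⇒ o)) →
  apps (liftCtx Ξ (ϱ A) (Ξ ↑ʳ here)) (N , tt)
    ≈ apps (var (Ξ ↑ʳ p₀)) (app N (var (Ξ ↑ʳ u₀)) , app N (var (Ξ ↑ʳ v₀)) , tt)
ϱ-↑ʳ {A} Ξ N = ≈trans (app-cong (≡⇒≈ (liftCtx-↑ʳ Ξ (ϱ A) here)) ≈refl) (β _ N)

ϱ-atomic : ∀ A → AtomicReduction (ϱ A)
ϱ-atomic A Ξ a b = by-cases (split Ξ a) (split Ξ b)
  where
  ↑ˡ-apps : (x : Ξ ∋ C) (Ms : Args (Ξ ++ Δ₀ A) C) →
    apps (liftCtx Ξ (ϱ A) (x ↑ˡ Γ₀ A)) Ms ≈ apps (var (x ↑ˡ Δ₀ A)) Ms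
  ↑ˡ-apps x Ms = ≡⇒≈ (cong (λ h → apps h Ms) (liftCtx-↑ˡ Ξ (ϱ A) x))
  u₀≢v₀ : Ξ ↑ʳ u₀ ≢ Ξ ↑ʳ v₀
  u₀≢v₀ e with ↑ʳ-injective Ξ e
  ... | ()
  by-cases : {a : (Ξ ++ Γ₀ A) ∋ C} {b : (Ξ ++ Γ₀ A) ∋ D} → Split Ξ a → Split Ξ b →
    (Ms : Args (Ξ ++ Δ₀ A) C) (Ns : Args (Ξ ++ Δ₀ A) D) →
    apps (liftCtx Ξ (ϱ A) a) Ms ≈ apps (liftCtx Ξ (ϱ A) b) Ns → SameHeadArgs a Ms b Ns
  by-cases (isˡ x) (isˡ y) Ms Ns e =
    SameHeadArgs-↑ˡ x y (apps-var-injective _ Ms _ Ns (≈-resp (↑ˡ-apps x Ms) (↑ˡ-apps y Ns) e))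
  by-cases (isˡ x) (isʳ here) Ms (N , tt) e =
    ⊥-elim (↑ˡ≢↑ʳ x p₀ (same-head
      (apps-var-injective _ Ms _ _ (≈-resp (↑ˡ-apps x Ms) (ϱ-↑ʳ Ξ N) e))))
  by-cases (isʳ here) (isˡ y) (M , tt) Ns e =
    ⊥-elim (↑ˡ≢↑ʳ y p₀ (same-head
      (apps-var-injective _ Ns _ _ (≈-resp (↑ˡ-apps y Ns) (ϱ-↑ʳ Ξ M) (≈sym e)))))
  by-cases (isʳ here) (isʳ here) (M , tt) (N , tt) e
    with same-args (apps-var-injective (Ξ ↑ʳ p₀) _ (Ξ ↑ʳ p₀) _ (≈-resp (ϱ-↑ʳ Ξ M) (ϱ-↑ʳ Ξ N) e))
  ... | Mu≈Nu , Mv≈Nv , tt = same (app-var-injective M N u₀≢v₀ Mu≈Nu Mv≈Nv , tt)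

lemmaL : ∀ (A : Ty) → ⟦ ⟦ ⟦ A ∷ [] ⟧ ∷ [] ⟧ ∷ [] ⟧ ≤ᵃ ⟦ ⟦ o ∷ o ∷ [] ⟧ ∷ A ∷ A ∷ [] ⟧
lemmaL A = ϱ A , ϱ-atomic A
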